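{- Let $(\Sigma,d)$ be a metric space and let $x,y$ be nonempty strings over $\Sigma$. Then there is an optimal (minimum-cost) correspondence between $x$ and $y$ in which either the final run of $x$ is not extended or the final run of $y$ is not extended. Consequently, if $x$ has $s$ runs with final run of length $j$, and $y$ has $t$ runs with final run of length $k$, then $$\operatorname{dtw}(x,y)=\min\big(\operatorname{SP}(x,y,s,t,k),\ \operatorname{SP}(y,x,t,s,j)\big).$$
   Context: Runs of a string are its maximal blocks of consecutive equal letters, numbered $1,2,\dots$ from left to right. An expansion of a string is obtained by replacing runs with longer runs of the same letter ("extending" them). A correspondence between strings $u$ and $v$ is a pair of equal-length expansions $(\overline{u},\overline{v})$; its cost is $\sum_i d(\overline{u}_i,\overline{v}_i)$; $\operatorname{dtw}(u,v)$ is the minimum cost of a correspondence. A run is said to be extended in a correspondence if its length in the expansion is larger than in the original string. For integers $r_x\ge 0$, $r_y\ge 0$, $o_y\ge 0$ (with $o_y=0$ if $r_y=0$, and $o_y$ at most the length of the $r_y$-th run of $y$), let $x'$ be the string consisting of the first $r_x$ runs of $x$, and $y'$ the string consisting of the first $r_y-1$ runs of $y$ followed by the first $o_y$ letters of the $r_y$-th run of $y$. Then $\operatorname{SP}(x,y,r_x,r_y,o_y)$ is the minimum cost of a correspondence between $x'$ and $y'$ in which the $r_y$-th run of $y'$ (its final $o_y$ letters) is not extended, and is $\infty$ if no such correspondence exists. $\operatorname{SP}(y,x,r_y,r_x,o_x)$ is defined symmetrically with the roles of $x$ and $y$ exchanged. -}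

module Defs where

open import Data.Nat using (ℕ; zero; suc) renaming (_≤_ to _≤ℕ_)
open import Data.List using (List; []; _∷_; _++_; map; zip; zipWith; length; take; replicate; concat; last; foldr)
open import Data.List.Relation.Binary.Pointwise using (Pointwise)
open import Data.Maybe using (Maybe; just; nothing)
open import Data.Product using (Σ; Σ-syntax; _×_; _,_; proj₁; proj₂)
open import Data.Sum using (_⊎_)
open import Data.Empty using (⊥)
open import Data.Unit using (⊤)
open import Relation.Nullary using (¬_)
open import Relation.Binary.PropositionalEquality using (_≡_)
open import Relation.Binary.Core using (Rel)
open import Relation.Binary.Structures using (IsTotalOrder)
open import Algebra.Structures using (IsCommutativeMonoid)

-- The paper uses real-valued metrics; agda-stdlib has no
-- reals, so distances take values in an arbitrary totally ordered
-- commutative monoid with monotone addition (ℝ with +, 0, ≤ is one).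

record CostDomain : Set₁ where
  field
    Carrier  : Set
    _≤_      : Rel Carrier _
    0#       : Carrier
    _+_      : Carrier → Carrier → Carrier
    +-isCommutativeMonoid : IsCommutativeMonoid _≡_ _+_ 0#
    ≤-isTotalOrder        : IsTotalOrder _≡_ _≤_
    +-monoˡ-≤ : ∀ a b c → a ≤ b → (a + c) ≤ (b + c)

  sumC : List Carrier → Carrier
  sumC = foldr _+_ 0#

record Metric (D : CostDomain) (S : Set) : Set where
  open CostDomain D
  field
    d         : S → S → Carrier
    nonneg    : ∀ a b → 0# ≤ d a b
    zero⇒eq   : ∀ a b → d a b ≡ 0# → a ≡ b
    eq⇒zero   : ∀ a → d a a ≡ 0#
    symmetric : ∀ a b → d a b ≡ d b a
    triangle  : ∀ a b c → d a c ≤ (d a b + d b c)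

module _ {S : Set} where

  Runs : Set
  Runs = List (S × ℕ)

  decode : Runs → List S
  decode rs = concat (map (λ p → replicate (proj₂ p) (proj₁ p)) rs)

  lengths : Runs → List ℕ
  lengths = map proj₂

  letters : Runs → List S
  letters = map proj₁

  data ValidRuns : Runs → Set where
    []  : ValidRuns []
    [_] : ∀ {a l} → 1 ≤ℕ l → ValidRuns ((a , l) ∷ [])
    cons : ∀ {a l b m rs} → 1 ≤ℕ l → ¬ (a ≡ b) →
           ValidRuns ((b , m) ∷ rs) → ValidRuns ((a , l) ∷ (b , m) ∷ rs)

  RunsOf : List S → Runs → Set
  RunsOf x rs = ValidRuns rs × decode rs ≡ x

  expandWith : Runs → List ℕ → List S
  expandWith rs ls = decode (zip (letters rs) ls)

  IsExpansion : Runs → List ℕ → Set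
  IsExpansion rs ls = Pointwise _≤ℕ_ (lengths rs) ls

  FinalNotExtended : Runs → List ℕ → Set
  FinalNotExtended rs ls = last ls ≡ last (lengths rs)

  -- A correspondence between the strings with runs ru and rv:
  -- a pair of equal-length expansions.
  record Correspondence (ru rv : Runs) : Set where
    constructor corr
    field
      lu : List ℕ
      lv : List ℕ
      expU : IsExpansion ru lu
      expV : IsExpansion rv lv
      sameLength : length (expandWith ru lu) ≡ length (expandWith rv lv)

  -- first o letters of the r-th run preceded by the first r-1 runs
  -- (as a run list; the final entry may have length 0)
  prefixRuns : Runs → ℕ → ℕ → Runs
  prefixRuns rs zero o = []
  prefixRuns [] (suc r) o = []
  prefixRuns ((b , l) ∷ rs) (suc zero) o = (b , o) ∷ []
  prefixRuns (p ∷ rs) (suc (suc r)) o = p ∷ prefixRuns rs (suc r) o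

module _ (D : CostDomain) {S : Set} (M : Metric D S) where
  open CostDomain D
  open Metric M

  cost : ∀ {ru rv : Runs {S}} → Correspondence ru rv → Carrier
  cost {ru} {rv} C =
    sumC (zipWith d (expandWith ru (Correspondence.lu C))
                    (expandWith rv (Correspondence.lv C)))

  Optimal : ∀ {ru rv : Runs {S}} → Correspondence ru rv → Set
  Optimal {ru} {rv} C = ∀ (C' : Correspondence ru rv) → cost C ≤ cost C'

  data Ext : Set where
    fin : Carrier → Ext
    ∞   : Ext

  data _≤∞_ : Ext → Ext → Set where
    fin≤fin : ∀ {a b} → a ≤ b → fin a ≤∞ fin b
    _≤∞∞    : ∀ e → e ≤∞ ∞

  IsMin2 : Ext → Ext → Ext → Set
  IsMin2 e₁ e₂ m = (m ≡ e₁ ⊎ m ≡ e₂) × m ≤∞ e₁ × m ≤∞ e₂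

  -- SP(x,y,r_x,r_y,o_y) for x, y with run decompositions rsx, rsy:
  -- correspondences between x' (first r_x runs) and y' in which the
  -- r_y-th run of y' is not extended.
  SPCorr : Runs {S} → Runs {S} → ℕ → ℕ → ℕ → Set
  SPCorr rsx rsy rx ry oy =
    Σ[ C ∈ Correspondence (take rx rsx) (prefixRuns rsy ry oy) ]
      FinalNotExtended (prefixRuns rsy ry oy) (Correspondence.lv C)

  IsSP : Runs {S} → Runs {S} → ℕ → ℕ → ℕ → Ext → Set
  IsSP rsx rsy rx ry oy c =
    (Σ[ P ∈ SPCorr rsx rsy rx ry oy ]
       (c ≡ fin (cost (proj₁ P)) ×
        ∀ (P' : SPCorr rsx rsy rx ry oy) → cost (proj₁ P) ≤ cost (proj₁ P')))
    ⊎ (c ≡ ∞ × ¬ SPCorr rsx rsy rx ry oy)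

module Submission where

-- Let (ū , v̄) be a correspondence between the strings with run
-- lists ru and rv.  Tag every letter of an expansion by whether its run is
-- extended.  If position p is tagged in both ū and v̄, deleting it from both
-- gives again a correspondence (every run keeps at least its original length),
-- and the cost drops by d(ū_p , v̄_p) ≥ 0.  Two instances of this deletion do
-- all the work:
--   * if both final runs are extended, both last positions are tagged; deleting
--     them repeatedly ends in a no more expensive correspondence in which some
--     final run is not extended (the first claim of the theorem);
--   * a correspondence longer than |x| + |y| has a common tagged position by
--     pigeonhole, as ū has at most |x| and v̄ at most |y| untagged positions.
-- By the second point every correspondence whose final run of y is not
-- extended is dominated by one of bounded length; there are finitely many of
-- those, so the value SP(x,y,s,t,k) is attained (or is ∞), and likewise
-- SP(y,x,t,s,j).  The cheaper of the two optima is then optimal among all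
-- correspondences by the first point, which gives the theorem.

open import Defs
open import Data.Nat using (ℕ; zero; suc; _+_; _≤_; _<_; _<ᵇ_; z≤n; s≤s; s<s⁻¹)
open import Data.Nat.Properties
  using (≤-refl; ≤-trans; ≤-reflexive; ≤-pred; +-suc; +-mono-≤; +-monoʳ-≤;
         n≤1+n; m≤m+n; m≤n+m; <ᵇ⇒<; <⇒<ᵇ; ≮⇒≥; <⇒≢; suc-injective; ≤∧≢⇒<; ≰⇒>;
         _≤?_; _≟_)
open import Data.Nat.Tactic.RingSolver using (solve-∀)
open import Data.Bool using (Bool; true; false; T)
open import Data.Unit using (tt)
open import Data.List
  using (List; []; _∷_; _++_; map; zipWith; replicate; length; last;
         upTo; cartesianProduct; cartesianProductWith; filter)
open import Data.Nat.ListAction using (sum)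
open import Data.List.Properties
  using (map-++; map-replicate; length-map; length-++; length-replicate; ++-identityʳ; take-all)
open import Data.List.Relation.Binary.Pointwise using (Pointwise; []; _∷_; Pointwise-length)
import Data.List.Relation.Binary.Pointwise.Properties as Pointwise
open import Data.List.Relation.Unary.All as All using (All; []; _∷_)
open import Data.List.Relation.Unary.All.Properties using (all-filter)
open import Data.List.Relation.Unary.Any using (here; there)
open import Data.List.Membership.Propositional using (_∈_)
open import Data.List.Membership.Propositional.Properties
  using (∈-upTo⁺; ∈-cartesianProductWith⁺; ∈-cartesianProduct⁺; ∈-filter⁺; ∉[])
import Data.List.Extrema as Extrema
open import Data.Maybe using (just)
import Data.Maybe.Properties as Maybe
open import Data.Product using (Σ-syntax; _×_; _,_; proj₁; proj₂)
open import Data.Sum as Sum using (_⊎_; inj₁; inj₂)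
open import Relation.Nullary using (¬_; Dec; yes; no; contradiction)
open import Relation.Nullary.Decidable using (_×-dec_)
open import Relation.Unary using (Decidable)
open import Data.Nat.Induction using (<-wellFounded)
open import Induction.WellFounded using (Acc; acc)
open import Relation.Binary.Bundles using (TotalOrder)
open import Relation.Binary.PropositionalEquality
  using (_≡_; refl; sym; trans; cong; cong₂; subst; subst₂; module ≡-Reasoning)
open import Algebra.Structures using (IsCommutativeMonoid)
open import Relation.Binary.Structures using (IsTotalOrder)

deleteAt : {A : Set} → ℕ → List A → List A
deleteAt _ [] = []
deleteAt zero (x ∷ xs) = xs
deleteAt (suc p) (x ∷ xs) = x ∷ deleteAt p xs

map-deleteAt : {A B : Set} (f : A → B) (p : ℕ) (xs : List A) →
               map f (deleteAt p xs) ≡ deleteAt p (map f xs)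
map-deleteAt f p [] = refl
map-deleteAt f zero (x ∷ xs) = refl
map-deleteAt f (suc p) (x ∷ xs) = cong (f x ∷_) (map-deleteAt f p xs)

length-deleteAt : {A : Set} (p : ℕ) (xs : List A) → p < length xs →
                  suc (length (deleteAt p xs)) ≡ length xs
length-deleteAt zero (x ∷ xs) _ = refl
length-deleteAt (suc p) (x ∷ xs) p<n = cong suc (length-deleteAt p xs (s<s⁻¹ p<n))

boundedLists : ℕ → ℕ → List (List ℕ)
boundedLists B zero = [] ∷ []
boundedLists B (suc n) = cartesianProductWith _∷_ (upTo (suc B)) (boundedLists B n)

∈-boundedLists : (B : ℕ) (xs : List ℕ) → All (_≤ B) xs → xs ∈ boundedLists B (length xs)
∈-boundedLists B [] [] = here refl
∈-boundedLists B (x ∷ xs) (x≤B ∷ xs≤B) =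
  ∈-cartesianProductWith⁺ _∷_ (∈-upTo⁺ (s≤s x≤B)) (∈-boundedLists B xs xs≤B)

module TaggedLists {A : Set} where

  data TaggedAt : ℕ → List (A × Bool) → Set where
    here  : ∀ {x xs} → T (proj₂ x) → TaggedAt zero (x ∷ xs)
    there : ∀ {p x xs} → TaggedAt p xs → TaggedAt (suc p) (x ∷ xs)

  taggedAt-< : ∀ {p xs} → TaggedAt p xs → p < length xs
  taggedAt-< (here _) = s≤s z≤n
  taggedAt-< (there t) = s≤s (taggedAt-< t)

  taggedAt-++ : ∀ xs {p ys} → TaggedAt p ys → TaggedAt (length xs + p) (xs ++ ys)
  taggedAt-++ [] t = t
  taggedAt-++ (x ∷ xs) t = there (taggedAt-++ xs t)

  taggedAt-blockEnd : ∀ n x ys → T (proj₂ x) → TaggedAt n (replicate (suc n) x ++ ys)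
  taggedAt-blockEnd zero x ys t = here t
  taggedAt-blockEnd (suc n) x ys t = there (taggedAt-blockEnd n x ys t)

  deleteAt-block : ∀ n x ys p → TaggedAt p (replicate n x ++ ys) →
    (Σ[ n' ∈ ℕ ] n ≡ suc n' × T (proj₂ x) × deleteAt p (replicate n x ++ ys) ≡ replicate n' x ++ ys)
    ⊎ (Σ[ q ∈ ℕ ] TaggedAt q ys × deleteAt p (replicate n x ++ ys) ≡ replicate n x ++ deleteAt q ys)
  deleteAt-block zero x ys p t = inj₂ (p , t , refl)
  deleteAt-block (suc n) x ys zero (here tx) = inj₁ (n , refl , tx , refl)
  deleteAt-block (suc n) x ys (suc p) (there t) with deleteAt-block n x ys p t
  ... | inj₁ (n' , refl , tx , e) = inj₁ (suc n' , refl , tx , cong (x ∷_) e)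
  ... | inj₂ (q , t' , e) = inj₂ (q , t' , cong (x ∷_) e)

  untagged : List (A × Bool) → ℕ
  untagged [] = 0
  untagged ((_ , true) ∷ xs) = untagged xs
  untagged ((_ , false) ∷ xs) = suc (untagged xs)

  untagged-taggedBlock : ∀ n a ys → untagged (replicate n (a , true) ++ ys) ≡ untagged ys
  untagged-taggedBlock zero a ys = refl
  untagged-taggedBlock (suc n) a ys = untagged-taggedBlock n a ys

  untagged-untaggedBlock : ∀ n a ys → untagged (replicate n (a , false) ++ ys) ≡ n + untagged ys
  untagged-untaggedBlock zero a ys = refl
  untagged-untaggedBlock (suc n) a ys = cong suc (untagged-untaggedBlock n a ys)

  later : ∀ {x y us vs} → Σ[ p ∈ ℕ ] TaggedAt p us × TaggedAt p vs →
          Σ[ p ∈ ℕ ] TaggedAt p (x ∷ us) × TaggedAt p (y ∷ vs)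
  later (p , tu , tv) = suc p , there tu , there tv

  commonTagged : ∀ us vs → length us ≡ length vs → untagged us + untagged vs < length us →
                 Σ[ p ∈ ℕ ] TaggedAt p us × TaggedAt p vs
  commonTagged ((_ , true) ∷ us) ((_ , true) ∷ vs) _ _ = zero , here tt , here tt
  commonTagged ((_ , true) ∷ us) ((_ , false) ∷ vs) eq lt =
    later (commonTagged us vs (suc-injective eq) (≤-trans (≤-reflexive (sym (+-suc _ _))) (≤-pred lt)))
  commonTagged ((_ , false) ∷ us) ((_ , true) ∷ vs) eq lt =
    later (commonTagged us vs (suc-injective eq) (s<s⁻¹ lt))
  commonTagged ((_ , false) ∷ us) ((_ , false) ∷ vs) eq lt =
    later (commonTagged us vs (suc-injective eq)
                        (≤-trans (s≤s (+-monoʳ-≤ (untagged us) (n≤1+n _))) (s<s⁻¹ lt)))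
  commonTagged [] [] _ ()
  commonTagged [] (_ ∷ _) () _
  commonTagged (_ ∷ _) [] () _

open TaggedLists

module _ {S : Set} where

  tag : Runs {S} → List ℕ → List (S × Bool)
  tag [] _ = []
  tag (_ ∷ _) [] = []
  tag ((a , m) ∷ rs) (n ∷ ns) = replicate n (a , (m <ᵇ n)) ++ tag rs ns

  forget-block : ∀ n (x : S × Bool) ys →
                 map proj₁ (replicate n x ++ ys) ≡ replicate n (proj₁ x) ++ map proj₁ ys
  forget-block n x ys =
    trans (map-++ proj₁ (replicate n x) ys) (cong (_++ map proj₁ ys) (map-replicate proj₁ n x))

  forget-tag : ∀ rs ls → map proj₁ (tag rs ls) ≡ expandWith rs ls
  forget-tag [] ls = refl
  forget-tag (_ ∷ _) [] = refl
  forget-tag ((a , m) ∷ rs) (n ∷ ns) =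
    trans (forget-block n (a , (m <ᵇ n)) (tag rs ns)) (cong (replicate n a ++_) (forget-tag rs ns))

  length-tag : ∀ rs ls → length (tag rs ls) ≡ length (expandWith rs ls)
  length-tag rs ls = trans (sym (length-map proj₁ (tag rs ls))) (cong length (forget-tag rs ls))

  -- Only letters of unextended runs are untagged, so an expansion of x has at
  -- most |x| untagged letters.
  untagged-tag : ∀ rs ls → IsExpansion rs ls → untagged (tag rs ls) ≤ sum (lengths rs)
  untagged-tag [] [] [] = z≤n
  untagged-tag ((a , m) ∷ rs) (n ∷ ns) (m≤n ∷ exp) with m <ᵇ n in extended
  ... | true = begin
        untagged (replicate n (a , true) ++ tag rs ns) ≡⟨ untagged-taggedBlock n a (tag rs ns) ⟩
        untagged (tag rs ns)                           ≤⟨ untagged-tag rs ns exp ⟩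
        sum (lengths rs)                               ≤⟨ m≤n+m _ m ⟩
        m + sum (lengths rs)                           ∎
    where open Data.Nat.Properties.≤-Reasoning
  ... | false = begin
        untagged (replicate n (a , false) ++ tag rs ns) ≡⟨ untagged-untaggedBlock n a (tag rs ns) ⟩
        n + untagged (tag rs ns)                        ≤⟨ +-mono-≤ n≤m (untagged-tag rs ns exp) ⟩
        m + sum (lengths rs)                            ∎
    where
    open Data.Nat.Properties.≤-Reasoning
    n≤m : n ≤ m
    n≤m = ≮⇒≥ (λ m<n → subst T extended (<⇒<ᵇ m<n))

  lastTagged : ∀ rs ls → IsExpansion rs ls → ¬ FinalNotExtended rs ls →
               Σ[ p ∈ ℕ ] TaggedAt p (tag rs ls) × suc p ≡ length (tag rs ls)
  lastTagged [] [] [] unextended = contradiction refl unextended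
  lastTagged ((a , m) ∷ []) (zero ∷ []) (z≤n ∷ []) unextended = contradiction refl unextended
  lastTagged ((a , m) ∷ []) (suc n ∷ []) (m≤n ∷ []) unextended =
    n , taggedAt-blockEnd n _ [] (<⇒<ᵇ m<1+n) ,
    sym (trans (cong length (++-identityʳ (replicate (suc n) _))) (length-replicate (suc n)))
    where
    m<1+n : m < suc n
    m<1+n = ≤∧≢⇒< m≤n (λ m≡1+n → unextended (cong just (sym m≡1+n)))
  lastTagged ((a , m) ∷ r ∷ rs) (n ∷ n' ∷ ns) (_ ∷ exp) unextended
    with p , t , p-last ← lastTagged (r ∷ rs) (n' ∷ ns) exp unextended =
    length block + p , taggedAt-++ block t ,
    trans (sym (+-suc (length block) p)) (trans (cong (length block +_) p-last) (sym (length-++ block)))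
    where block = replicate n (a , (m <ᵇ n))

  data OneLess : List ℕ → List ℕ → List ℕ → Set where
    here  : ∀ {m n ms ns} → m ≤ n → OneLess (m ∷ ms) (suc n ∷ ns) (n ∷ ns)
    there : ∀ {m n ms ns ns'} → OneLess ms ns ns' → OneLess (m ∷ ms) (n ∷ ns) (n ∷ ns')

  oneLess-expansion : ∀ {ms ns ns'} → Pointwise _≤_ ms ns → OneLess ms ns ns' → Pointwise _≤_ ms ns'
  oneLess-expansion (_ ∷ exp) (here m≤n) = m≤n ∷ exp
  oneLess-expansion (m≤n ∷ exp) (there less) = m≤n ∷ oneLess-expansion exp less

  oneLess-final : ∀ {ms ns ns'} → Pointwise _≤_ ms ns → OneLess ms ns ns' →
                  last ns ≡ last ms → last ns' ≡ last ms
  oneLess-final (_ ∷ []) (here m≤n) final =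
    contradiction (sym (Maybe.just-injective final)) (<⇒≢ (s≤s m≤n))
  oneLess-final (_ ∷ _ ∷ _) (here _) final = final
  oneLess-final (_ ∷ []) (there ()) final
  oneLess-final (_ ∷ exp@(_ ∷ _)) (there less@(here _)) final = oneLess-final exp less final
  oneLess-final (_ ∷ exp@(_ ∷ _)) (there less@(there _)) final = oneLess-final exp less final

  deleteTagged-letters : ∀ rs ls p → TaggedAt p (tag rs ls) →
    Σ[ ls' ∈ List ℕ ] OneLess (lengths rs) ls ls' × expandWith rs ls' ≡ map proj₁ (deleteAt p (tag rs ls))
  deleteTagged-letters ((a , m) ∷ rs) (n ∷ ns) p t with deleteAt-block n (a , (m <ᵇ n)) (tag rs ns) p t
  ... | inj₁ (n' , refl , extended , e) =
    n' ∷ ns , here (≤-pred (<ᵇ⇒< m (suc n') extended)) , (begin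
        replicate n' a ++ expandWith rs ns                   ≡⟨ cong (replicate n' a ++_) (forget-tag rs ns) ⟨
        replicate n' a ++ map proj₁ (tag rs ns)              ≡⟨ forget-block n' _ (tag rs ns) ⟨
        map proj₁ (replicate n' (a , (m <ᵇ n)) ++ tag rs ns) ≡⟨ cong (map proj₁) e ⟨
        map proj₁ (deleteAt p (tag ((a , m) ∷ rs) (n ∷ ns))) ∎)
    where open ≡-Reasoning
  ... | inj₂ (q , t' , e) with ls' , less , e' ← deleteTagged-letters rs ns q t' =
    n ∷ ls' , there less , (begin
        replicate n a ++ expandWith rs ls'                               ≡⟨ cong (replicate n a ++_) e' ⟩
        replicate n a ++ map proj₁ (deleteAt q (tag rs ns))              ≡⟨ forget-block n _ (deleteAt q (tag rs ns)) ⟨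
        map proj₁ (replicate n (a , (m <ᵇ n)) ++ deleteAt q (tag rs ns)) ≡⟨ cong (map proj₁) e ⟨
        map proj₁ (deleteAt p (tag ((a , m) ∷ rs) (n ∷ ns)))             ∎)
    where open ≡-Reasoning

  deleteTagged : ∀ rs ls p → TaggedAt p (tag rs ls) →
                 Σ[ ls' ∈ List ℕ ] OneLess (lengths rs) ls ls' × expandWith rs ls' ≡ deleteAt p (expandWith rs ls)
  deleteTagged rs ls p t with ls' , less , e ← deleteTagged-letters rs ls p t =
    ls' , less , trans e (trans (map-deleteAt proj₁ p (tag rs ls)) (cong (deleteAt p) (forget-tag rs ls)))

  length-expand-cons : ∀ a m (rs : Runs {S}) n ns →
                       length (expandWith ((a , m) ∷ rs) (n ∷ ns)) ≡ n + length (expandWith rs ns)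
  length-expand-cons a m rs n ns =
    trans (length-++ (replicate n a)) (cong (_+ length (expandWith rs ns)) (length-replicate n))

  runs-≤-length : ∀ (rs : Runs {S}) ls → IsExpansion rs ls → All (_≤ length (expandWith rs ls)) ls
  runs-≤-length [] [] [] = []
  runs-≤-length ((a , m) ∷ rs) (n ∷ ns) (_ ∷ exp) =
    subst (n ≤_) (sym total) (m≤m+n n _) ∷
    All.map (λ l≤ → subst (_ ≤_) (sym total) (≤-trans l≤ (m≤n+m _ n))) (runs-≤-length rs ns exp)
    where total = length-expand-cons a m rs n ns

  -- Two nonempty strings always have a correspondence: pad the first run of
  -- each by the number of remaining letters of the other.
  padded : ∀ a m (rs : Runs {S}) b m' (rs' : Runs {S}) → Correspondence ((a , m) ∷ rs) ((b , m') ∷ rs')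
  padded a m rs b m' rs' =
    corr ((m + (m' + V)) ∷ lengths rs) ((m' + (m + U)) ∷ lengths rs')
         (m≤m+n m _ ∷ Pointwise.refl ≤-refl) (m≤m+n m' _ ∷ Pointwise.refl ≤-refl)
         (begin
           length (expandWith ((a , m) ∷ rs) ((m + (m' + V)) ∷ lengths rs))
             ≡⟨ length-expand-cons a m rs _ _ ⟩
           m + (m' + V) + U
             ≡⟨ regroup m m' U V ⟩
           m' + (m + U) + V
             ≡⟨ length-expand-cons b m' rs' _ _ ⟨
           length (expandWith ((b , m') ∷ rs') ((m' + (m + U)) ∷ lengths rs')) ∎)
    where
    open ≡-Reasoning
    U = length (expandWith rs (lengths rs))
    V = length (expandWith rs' (lengths rs'))
    regroup : ∀ m m' U V → m + (m' + V) + U ≡ m' + (m + U) + V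
    regroup = solve-∀

  finalNotExtended? : ∀ (rs : Runs {S}) ls → Dec (FinalNotExtended rs ls)
  finalNotExtended? rs ls = Maybe.≡-dec _≟_ (last ls) (last (lengths rs))

  prefixRuns-whole : ∀ (rs : Runs {S}) k → last (lengths rs) ≡ just k → prefixRuns rs (length rs) k ≡ rs
  prefixRuns-whole ((b , l) ∷ []) k final rewrite Maybe.just-injective final = refl
  prefixRuns-whole (r ∷ r' ∷ rs) k final = cong (r ∷_) (prefixRuns-whole (r' ∷ rs) k final)

module Costs (D : CostDomain) {S : Set} (M : Metric D S) where
  open CostDomain D using (Carrier; 0#; sumC; +-monoˡ-≤; +-isCommutativeMonoid; ≤-isTotalOrder)
    renaming (_≤_ to _≼_; _+_ to _⊕_)
  open Metric M using (d; nonneg; symmetric)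
  open IsTotalOrder ≤-isTotalOrder using (total) renaming (refl to ≼-refl; trans to ≼-trans)
  open IsCommutativeMonoid +-isCommutativeMonoid using (comm; identityˡ)
  open Correspondence

  ⊕-monoʳ : ∀ c {a b} → a ≼ b → (c ⊕ a) ≼ (c ⊕ b)
  ⊕-monoʳ c {a} {b} a≼b = subst₂ _≼_ (comm a c) (comm b c) (+-monoˡ-≤ a b c a≼b)

  ≼-⊕ˡ : ∀ a c → 0# ≼ a → c ≼ (a ⊕ c)
  ≼-⊕ˡ a c 0≼a = subst (_≼ (a ⊕ c)) (identityˡ c) (+-monoˡ-≤ 0# a c 0≼a)

  pairCost : List S → List S → Carrier
  pairCost u v = sumC (zipWith d u v)

  pairCost-comm : ∀ u v → pairCost u v ≡ pairCost v u
  pairCost-comm [] [] = refl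
  pairCost-comm [] (_ ∷ _) = refl
  pairCost-comm (_ ∷ _) [] = refl
  pairCost-comm (a ∷ u) (b ∷ v) = cong₂ _⊕_ (symmetric a b) (pairCost-comm u v)

  pairCost-deleteAt : ∀ p u v → pairCost (deleteAt p u) (deleteAt p v) ≼ pairCost u v
  pairCost-deleteAt p [] v = ≼-refl
  pairCost-deleteAt zero (a ∷ []) [] = ≼-refl
  pairCost-deleteAt zero (a ∷ b ∷ u) [] = ≼-refl
  pairCost-deleteAt (suc p) (a ∷ u) [] = ≼-refl
  pairCost-deleteAt zero (a ∷ u) (b ∷ v) = ≼-⊕ˡ (d a b) _ (nonneg a b)
  pairCost-deleteAt (suc p) (a ∷ u) (b ∷ v) = ⊕-monoʳ (d a b) (pairCost-deleteAt p u v)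

  costOf : ∀ {ru rv : Runs {S}} → Correspondence ru rv → Carrier
  costOf = cost D M

  swap : ∀ {ru rv : Runs {S}} → Correspondence ru rv → Correspondence rv ru
  swap (corr lu lv expU expV sameLength) = corr lv lu expV expU (sym sameLength)

  cost-swap : ∀ {ru rv : Runs {S}} (C : Correspondence ru rv) → costOf (swap C) ≡ costOf C
  cost-swap {ru} {rv} C = pairCost-comm (expandWith rv (lv C)) (expandWith ru (lu C))

  descend : {A : Set} (size : A → ℕ) (price : A → Carrier) (Goal : A → Set) →
            (∀ a → Goal a ⊎ Σ[ a' ∈ A ] size a' < size a × price a' ≼ price a) →
            ∀ a → Σ[ a' ∈ A ] Goal a' × price a' ≼ price a
  descend {A} size price Goal improve a = go a (<-wellFounded (size a))
    where
    go : ∀ a → Acc _<_ (size a) → Σ[ a' ∈ A ] Goal a' × price a' ≼ price a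
    go a (acc smaller) with improve a
    ... | inj₁ reached = a , reached , ≼-refl
    ... | inj₂ (a' , shorter , cheaper) with a'' , reached , cheaper' ← go a' (smaller shorter) =
          a'' , reached , ≼-trans cheaper' cheaper

  costOrder : TotalOrder _ _ _
  costOrder = record { isTotalOrder = ≤-isTotalOrder }

  open Extrema costOrder using (argmin; argmin-all; f[argmin]≤f[⊤]; f[argmin]≤f[xs])

  leastAmong : {A : Set} {P : A → Set} → Decidable P → (price : A → Carrier) → (xs : List A) →
               (Σ[ a ∈ A ] P a × (∀ {b} → b ∈ xs → P b → price a ≼ price b)) ⊎ (∀ {b} → b ∈ xs → ¬ P b)
  leastAmong P? price xs
    with filter P? xs | all-filter P? xs | (λ {b} (b∈xs : b ∈ xs) → ∈-filter⁺ P? b∈xs)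
  ... | [] | [] | kept = inj₂ (λ b∈xs pb → ∉[] (kept b∈xs pb))
  ... | a ∷ as | pa ∷ pas | kept =
    inj₁ (argmin price a as , argmin-all price pa pas , λ b∈xs pb → least (kept b∈xs pb))
    where
    least : ∀ {b} → b ∈ a ∷ as → price (argmin price a as) ≼ price b
    least (here refl) = f[argmin]≤f[⊤] {f = price} a as
    least (there b∈as) = All.lookup (f[argmin]≤f[xs] {f = price} a as) b∈as

  FinalFixed : Runs {S} → Runs {S} → Set
  FinalFixed ru rv = Σ[ C ∈ Correspondence ru rv ] FinalNotExtended rv (lv C)

  -- c is the least cost of such a correspondence, or ∞ if there is none; for
  -- the full run lists of x and y this is SP(x,y,s,t,k) (see asSP below)
  IsFinalMin : Runs {S} → Runs {S} → Ext D M → Set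
  IsFinalMin ru rv c =
    (Σ[ P ∈ FinalFixed ru rv ]
       (c ≡ fin (costOf (proj₁ P)) × ∀ (P' : FinalFixed ru rv) → costOf (proj₁ P) ≼ costOf (proj₁ P')))
    ⊎ (c ≡ ∞ × ¬ FinalFixed ru rv)

  module Shrinking (ru rv : Runs {S}) where

    size : Correspondence ru rv → ℕ
    size C = length (expandWith ru (lu C))

    tags-sameLength : (C : Correspondence ru rv) → length (tag ru (lu C)) ≡ length (tag rv (lv C))
    tags-sameLength C = trans (length-tag ru (lu C)) (trans (sameLength C) (sym (length-tag rv (lv C))))

    shrinkAt : (C : Correspondence ru rv) (p : ℕ) → TaggedAt p (tag ru (lu C)) → TaggedAt p (tag rv (lv C)) →
               Σ[ C' ∈ Correspondence ru rv ]
                 OneLess (lengths rv) (lv C) (lv C') × size C' < size C × costOf C' ≼ costOf C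
    shrinkAt C p tu tv
      with lu' , lessU , eu ← deleteTagged ru (lu C) p tu | lv' , lessV , ev ← deleteTagged rv (lv C) p tv =
      corr lu' lv' (oneLess-expansion (expU C) lessU) (oneLess-expansion (expV C) lessV) sameLength' ,
      lessV , ≤-reflexive shorterU , cheaper
      where
      shorter : ∀ (rs : Runs {S}) ls ls' → expandWith rs ls' ≡ deleteAt p (expandWith rs ls) →
                TaggedAt p (tag rs ls) → suc (length (expandWith rs ls')) ≡ length (expandWith rs ls)
      shorter rs ls ls' e t =
        trans (cong (λ u → suc (length u)) e)
              (length-deleteAt p (expandWith rs ls) (subst (p <_) (length-tag rs ls) (taggedAt-< t)))
      shorterU = shorter ru (lu C) lu' eu tu
      sameLength' = suc-injective (trans shorterU (trans (sameLength C) (sym (shorter rv (lv C) lv' ev tv))))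
      cheaper : pairCost (expandWith ru lu') (expandWith rv lv') ≼ costOf C
      cheaper = subst₂ (λ u v → pairCost u v ≼ costOf C) (sym eu) (sym ev)
                       (pairCost-deleteAt p (expandWith ru (lu C)) (expandWith rv (lv C)))

    FinalSettled : Correspondence ru rv → Set
    FinalSettled C = FinalNotExtended ru (lu C) ⊎ FinalNotExtended rv (lv C)

    sameEnd : (C : Correspondence ru rv) → ∀ {p q} →
              suc p ≡ length (tag ru (lu C)) → suc q ≡ length (tag rv (lv C)) → q ≡ p
    sameEnd C endU endV = suc-injective (trans endV (trans (sym (tags-sameLength C)) (sym endU)))

    settleStep : (C : Correspondence ru rv) →
                 FinalSettled C ⊎ Σ[ C' ∈ Correspondence ru rv ] size C' < size C × costOf C' ≼ costOf C
    settleStep C with finalNotExtended? ru (lu C) | finalNotExtended? rv (lv C)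
    ... | yes finalU | _ = inj₁ (inj₁ finalU)
    ... | no _ | yes finalV = inj₁ (inj₂ finalV)
    ... | no extendedU | no extendedV
      with p , tu , endU ← lastTagged ru (lu C) (expU C) extendedU
         | q , tv , endV ← lastTagged rv (lv C) (expV C) extendedV
      with C' , _ , shorter , cheaper ←
             shrinkAt C p tu (subst (λ i → TaggedAt i (tag rv (lv C))) (sameEnd C endU endV) tv)
      = inj₂ (C' , shorter , cheaper)

    settle : (C : Correspondence ru rv) →
             Σ[ C' ∈ Correspondence ru rv ] FinalSettled C' × costOf C' ≼ costOf C
    settle = descend size costOf FinalSettled settleStep

    bound : ℕ
    bound = sum (lengths ru) + sum (lengths rv)

    fewUntagged : (C : Correspondence ru rv) → ¬ size C ≤ bound →
                  untagged (tag ru (lu C)) + untagged (tag rv (lv C)) < length (tag ru (lu C))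
    fewUntagged C long = begin-strict
      untagged (tag ru (lu C)) + untagged (tag rv (lv C))
        ≤⟨ +-mono-≤ (untagged-tag ru (lu C) (expU C)) (untagged-tag rv (lv C) (expV C)) ⟩
      bound  <⟨ ≰⇒> long ⟩
      size C ≡⟨ length-tag ru (lu C) ⟨
      length (tag ru (lu C)) ∎
      where open Data.Nat.Properties.≤-Reasoning

    shrinkLong : (P : FinalFixed ru rv) →
                 size (proj₁ P) ≤ bound
                 ⊎ Σ[ P' ∈ FinalFixed ru rv ]
                     size (proj₁ P') < size (proj₁ P) × costOf (proj₁ P') ≼ costOf (proj₁ P)
    shrinkLong (C , final) with size C ≤? bound
    ... | yes short = inj₁ short
    ... | no long
      with p , tu , tv ← commonTagged (tag ru (lu C)) (tag rv (lv C)) (tags-sameLength C) (fewUntagged C long)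
      with C' , lessV , shorter , cheaper ← shrinkAt C p tu tv
      = inj₂ ((C' , oneLess-final (expV C) lessV final) , shorter , cheaper)

    shorten : (P : FinalFixed ru rv) →
              Σ[ P' ∈ FinalFixed ru rv ] size (proj₁ P') ≤ bound × costOf (proj₁ P') ≼ costOf (proj₁ P)
    shorten = descend (λ P → size (proj₁ P)) (λ P → costOf (proj₁ P)) (λ P → size (proj₁ P) ≤ bound)
                      shrinkLong

    Admissible : List ℕ × List ℕ → Set
    Admissible (lu , lv) = IsExpansion ru lu × IsExpansion rv lv ×
                           length (expandWith ru lu) ≡ length (expandWith rv lv) × FinalNotExtended rv lv

    admissible? : Decidable Admissible
    admissible? (lu , lv) =
      Pointwise.decidable _≤?_ (lengths ru) lu ×-dec Pointwise.decidable _≤?_ (lengths rv) lv ×-dec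
      (length (expandWith ru lu) ≟ length (expandWith rv lv)) ×-dec finalNotExtended? rv lv

    fromAdmissible : ∀ q → Admissible q → FinalFixed ru rv
    fromAdmissible (lu , lv) (expU , expV , sameLength , final) = corr lu lv expU expV sameLength , final

    lengthsOf : FinalFixed ru rv → List ℕ × List ℕ
    lengthsOf (C , _) = lu C , lv C

    admissible : (P : FinalFixed ru rv) → Admissible (lengthsOf P)
    admissible (C , final) = expU C , expV C , sameLength C , final

    candidates : List (List ℕ × List ℕ)
    candidates = cartesianProduct (boundedLists bound (length ru)) (boundedLists bound (length rv))

    ∈-candidates : (P : FinalFixed ru rv) → size (proj₁ P) ≤ bound → lengthsOf P ∈ candidates
    ∈-candidates (C , _) short =
      ∈-cartesianProduct⁺ (bounded ru (lu C) (expU C) short)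
                          (bounded rv (lv C) (expV C) (subst (_≤ bound) (sameLength C) short))
      where
      bounded : ∀ rs ls → IsExpansion rs ls → length (expandWith rs ls) ≤ bound →
                ls ∈ boundedLists bound (length rs)
      bounded rs ls exp short =
        subst (λ n → ls ∈ boundedLists bound n) (trans (sym (Pointwise-length exp)) (length-map proj₂ rs))
              (∈-boundedLists bound ls (All.map (λ l≤ → ≤-trans l≤ short) (runs-≤-length rs ls exp)))

    -- SP is attained: a cheapest admissible candidate is a cheapest final-fixed
    -- correspondence, since every one is dominated by a candidate.
    finalMin : Σ[ c ∈ Ext D M ] IsFinalMin ru rv c
    finalMin with leastAmong admissible? (λ (lu , lv) → pairCost (expandWith ru lu) (expandWith rv lv)) candidates
    ... | inj₁ (q , adm , least) =
      fin (costOf (proj₁ (fromAdmissible q adm))) , inj₁ (fromAdmissible q adm , refl , minimal)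
      where
      minimal : ∀ P → costOf (proj₁ (fromAdmissible q adm)) ≼ costOf (proj₁ P)
      minimal P with P' , short , cheaper ← shorten P =
        ≼-trans (least (∈-candidates P' short) (admissible P')) cheaper
    ... | inj₂ none = ∞ , inj₂ (refl , empty)
      where
      empty : ¬ FinalFixed ru rv
      empty P with P' , short , _ ← shorten P = none (∈-candidates P' short) (admissible P')

  open Shrinking using (settle; finalMin)

  dominated : ∀ {ru rv} (C : Correspondence ru rv) →
              (Σ[ P ∈ FinalFixed ru rv ] costOf (proj₁ P) ≼ costOf C)
              ⊎ (Σ[ P ∈ FinalFixed rv ru ] costOf (proj₁ P) ≼ costOf C)
  dominated {ru} {rv} C with settle ru rv C
  ... | C' , inj₂ finalV , cheaper = inj₁ ((C' , finalV) , cheaper)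
  ... | C' , inj₁ finalU , cheaper =
    inj₂ ((swap C' , finalU) , subst (_≼ costOf C) (sym (cost-swap C')) cheaper)

  _⊑_ : Ext D M → Ext D M → Set
  _⊑_ = _≤∞_ D M

  ⊑-total : ∀ (e e' : Ext D M) → e ⊑ e' ⊎ e' ⊑ e
  ⊑-total (fin a) (fin b) with total a b
  ... | inj₁ a≼b = inj₁ (fin≤fin a≼b)
  ... | inj₂ b≼a = inj₂ (fin≤fin b≼a)
  ⊑-total e ∞ = inj₁ (_ ≤∞∞)
  ⊑-total ∞ e = inj₂ (_ ≤∞∞)

  below-finalMin : ∀ {ru rv c v} → IsFinalMin ru rv c → fin v ⊑ c →
                   ∀ (P : FinalFixed ru rv) → v ≼ costOf (proj₁ P)
  below-finalMin (inj₁ (P₀ , refl , least)) (fin≤fin v≼c) P = ≼-trans v≼c (least P)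
  below-finalMin (inj₂ (refl , none)) _ P = contradiction P none

  Outcome : Runs {S} → Runs {S} → Set
  Outcome ru rv = Σ[ C ∈ Correspondence ru rv ]
    (Optimal D M C × (FinalNotExtended ru (lu C) ⊎ FinalNotExtended rv (lv C))
     × Σ[ c₁ ∈ Ext D M ] Σ[ c₂ ∈ Ext D M ]
         (IsFinalMin ru rv c₁ × IsFinalMin rv ru c₂ × IsMin2 D M c₁ c₂ (fin (costOf C))))

  outcome-swap : ∀ {ru rv} → Outcome rv ru → Outcome ru rv
  outcome-swap (C , optimal , settled , c₁ , c₂ , i₁ , i₂ , (which , ≤c₁ , ≤c₂)) =
    swap C , optimal' , Sum.swap settled , c₂ , c₁ , i₂ , i₁ ,
    subst (IsMin2 D M c₂ c₁) (cong fin (sym (cost-swap C))) (Sum.swap which , ≤c₂ , ≤c₁)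
    where
    optimal' : Optimal D M (swap C)
    optimal' C' = subst₂ _≼_ (sym (cost-swap C)) (cost-swap C') (optimal (swap C'))

  -- If SP(ru,rv) ≤ SP(rv,ru), an optimum for SP(ru,rv) is optimal overall;
  -- both cannot be ∞ as long as some correspondence exists.
  leftWins : ∀ {ru rv c₁ c₂} → Correspondence ru rv →
             IsFinalMin ru rv c₁ → IsFinalMin rv ru c₂ → c₁ ⊑ c₂ → Outcome ru rv
  leftWins _ i₁@(inj₁ (P₁ , refl , least₁)) i₂ c₁≤c₂ =
    proj₁ P₁ , optimal , inj₂ (proj₂ P₁) , _ , _ , i₁ , i₂ , inj₁ refl , fin≤fin ≼-refl , c₁≤c₂
    where
    optimal : Optimal D M (proj₁ P₁)
    optimal C with dominated C
    ... | inj₁ (P , cheaper) = ≼-trans (least₁ P) cheaper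
    ... | inj₂ (P , cheaper) = ≼-trans (below-finalMin i₂ c₁≤c₂ P) cheaper
  leftWins C₀ (inj₂ (refl , none₁)) (inj₁ (_ , refl , _)) ()
  leftWins C₀ (inj₂ (refl , none₁)) (inj₂ (refl , none₂)) _ with dominated C₀
  ... | inj₁ (P , _) = contradiction P none₁
  ... | inj₂ (P , _) = contradiction P none₂

  outcome : ∀ ru rv → Correspondence ru rv → Outcome ru rv
  outcome ru rv C₀ with c₁ , i₁ ← finalMin ru rv | c₂ , i₂ ← finalMin rv ru | ⊑-total c₁ c₂
  ... | inj₁ c₁≤c₂ = leftWins C₀ i₁ i₂ c₁≤c₂
  ... | inj₂ c₂≤c₁ = outcome-swap (leftWins (swap C₀) i₂ i₁ c₂≤c₁)

-- For the full run lists of x and y, the final-fixed minimum is SP(x,y,s,t,k):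
-- x' is all of x and y' all of y.
asSP : (D : CostDomain) {S : Set} (M : Metric D S) (ru rv : Runs {S}) (k : ℕ) {c : Ext D M} →
       last (lengths rv) ≡ just k → Costs.IsFinalMin D M ru rv c → IsSP D M ru rv (length ru) (length rv) k c
asSP D M ru rv k {c} final isMin =
  subst₂ (λ ru' rv' → Costs.IsFinalMin D M ru' rv' c)
         (sym (take-all (length ru) ru ≤-refl)) (sym (prefixRuns-whole rv k final)) isMin

mainTheorem3 : (D : CostDomain) {S : Set} (M : Metric D S)
    (x y : List S) → ¬ (x ≡ []) → ¬ (y ≡ []) →
    (rx ry : Runs {S}) → RunsOf x rx → RunsOf y ry →
    (s j t k : ℕ) →
    length rx ≡ s → last (lengths rx) ≡ just j →
    length ry ≡ t → last (lengths ry) ≡ just k →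
    Σ[ C ∈ Correspondence rx ry ]
      (Optimal D M C
       × (FinalNotExtended rx (Correspondence.lu C)
          ⊎ FinalNotExtended ry (Correspondence.lv C))
       × Σ[ c₁ ∈ Ext D M ] Σ[ c₂ ∈ Ext D M ]
           (IsSP D M rx ry s t k c₁
            × IsSP D M ry rx t s j c₂
            × IsMin2 D M c₁ c₂ (fin (cost D M C))))
mainTheorem3 D M x y _ _ [] ry _ _ s j t k _ () _ _
mainTheorem3 D M x y _ _ (_ ∷ _) [] _ _ s j t k _ _ _ ()
mainTheorem3 D M x y _ _ rx@((a , m) ∷ rs) ry@((b , m') ∷ rs') _ _ _ j _ k refl finalX refl finalY
  with C , optimal , settled , c₁ , c₂ , i₁ , i₂ , isMin ← Costs.outcome D M rx ry (padded a m rs b m' rs') =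
  C , optimal , settled , c₁ , c₂ , asSP D M rx ry k finalY i₁ , asSP D M ry rx j finalX i₂ , isMin
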